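{- Let $(A,\sqcup,\underline{\phantom{a}}[\underline{\phantom{a}}])$ be an algebra satisfying: $\sqcup$ is associative and idempotent; $x=x[x\sqcup y]$; $x\sqcup y=y[x]\sqcup x$; $x[y][z]=x[z\sqcup y]$; $(x\sqcup y)[z]=x[z]\sqcup y[z]$; $x[y[x[z]]]=x[y[x][z]]$; $w[x[y[w[z]]]]=w[x[y[w][z]]]$. Then $A$ satisfies $x[y]\sqcup x=x[y]$, $x\sqcup x[y]=x$, $x[y]\sqcup y=y\sqcup x[y]$, $y\sqcup x[y]=y\sqcup x$, as well as $x\sqcup(y\sqcup z)=(x\sqcup y)\sqcup z$, $x\sqcup x=x$ and $x\sqcup y\sqcup x=x\sqcup y$.
   Context: Convention: $u[v][w]$ means $(u[v])[w]$; the operations are abstract binary operations on the set $A$. -}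

module Defs where

open import Level using (Level; suc)
open import Relation.Binary.PropositionalEquality using (_≡_)

record Algebra (a : Level) : Set (suc a) where
  infixl 7 _⟦_⟧
  infixl 6 _⊔_
  field
    Carrier : Set a
    _⊔_  : Carrier → Carrier → Carrier
    _⟦_⟧ : Carrier → Carrier → Carrier

record Axioms {a : Level} (𝔸 : Algebra a) : Set a where
  open Algebra 𝔸
  field
    ⊔-assoc : ∀ x y z → (x ⊔ y) ⊔ z ≡ x ⊔ (y ⊔ z)
    ⊔-idem  : ∀ x → x ⊔ x ≡ x
    ax1 : ∀ x y → x ≡ x ⟦ x ⊔ y ⟧
    ax2 : ∀ x y → x ⊔ y ≡ y ⟦ x ⟧ ⊔ x
    ax3 : ∀ x y z → x ⟦ y ⟧ ⟦ z ⟧ ≡ x ⟦ z ⊔ y ⟧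
    ax4 : ∀ x y z → (x ⊔ y) ⟦ z ⟧ ≡ x ⟦ z ⟧ ⊔ y ⟦ z ⟧
    ax5 : ∀ x y z → x ⟦ y ⟦ x ⟦ z ⟧ ⟧ ⟧ ≡ x ⟦ y ⟦ x ⟧ ⟦ z ⟧ ⟧
    ax6 : ∀ w x y z → w ⟦ x ⟦ y ⟦ w ⟦ z ⟧ ⟧ ⟧ ⟧ ≡ w ⟦ x ⟦ y ⟦ w ⟧ ⟦ z ⟧ ⟧ ⟧

record Conclusions {a : Level} (𝔸 : Algebra a) : Set a where
  open Algebra 𝔸
  field
    c1 : ∀ x y → x ⟦ y ⟧ ⊔ x ≡ x ⟦ y ⟧
    c2 : ∀ x y → x ⊔ x ⟦ y ⟧ ≡ x
    c3 : ∀ x y → x ⟦ y ⟧ ⊔ y ≡ y ⊔ x ⟦ y ⟧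
    c4 : ∀ x y → y ⊔ x ⟦ y ⟧ ≡ y ⊔ x
    c5 : ∀ x y z → x ⊔ (y ⊔ z) ≡ (x ⊔ y) ⊔ z
    c6 : ∀ x → x ⊔ x ≡ x
    c7 : ∀ x y → (x ⊔ y) ⊔ x ≡ x ⊔ y

-- Only four hypotheses are needed: associativity and idempotence of ⊔,
-- the absorption law  x = x[x ⊔ y]  (ax1), the exchange law
-- x ⊔ y = y[x] ⊔ x  (ax2) and the composition law  x[y][z] = x[z ⊔ y]
-- (ax3).  The central observation is that bracketing back by the base
-- element undoes a bracket:  x[y][x] = x[x ⊔ y] = x.  Combined with the
-- exchange law this gives  x ⊔ x[y] = x  (c2), and applying that to x[y]
-- gives  x[y] ⊔ x = x[y]  (c1).  The exchange law together with
-- x[y][y] = x[y]  yields c3 and c4, and c7 follows from exchange,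
-- absorption, associativity and idempotence.
module Submission where

open import Defs
open import Level using (Level)
open import Relation.Binary.PropositionalEquality using (_≡_; sym; trans; cong; module ≡-Reasoning)

module Consequences {a : Level} (𝔸 : Algebra a) (axioms : Axioms 𝔸) where
  open Algebra 𝔸
  open Axioms axioms
  open ≡-Reasoning

  bracket-back : ∀ x y → x ⟦ y ⟧ ⟦ x ⟧ ≡ x
  bracket-back x y = trans (ax3 x y x) (sym (ax1 x y))

  bracket-twice : ∀ x y → x ⟦ y ⟧ ⟦ y ⟧ ≡ x ⟦ y ⟧
  bracket-twice x y = begin
    x ⟦ y ⟧ ⟦ y ⟧ ≡⟨ ax3 x y y ⟩
    x ⟦ y ⊔ y ⟧   ≡⟨ cong (x ⟦_⟧) (⊔-idem y) ⟩
    x ⟦ y ⟧       ∎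

  ⊔-absorbs-bracket : ∀ x y → x ⊔ x ⟦ y ⟧ ≡ x
  ⊔-absorbs-bracket x y = begin
    x ⊔ x ⟦ y ⟧       ≡⟨ ax2 x (x ⟦ y ⟧) ⟩
    x ⟦ y ⟧ ⟦ x ⟧ ⊔ x ≡⟨ cong (_⊔ x) (bracket-back x y) ⟩
    x ⊔ x             ≡⟨ ⊔-idem x ⟩
    x                 ∎

  -- A bracketed element absorbs its base from the right: apply the
  -- previous law to x[y], rewriting x as x[y][x].
  bracket-absorbs-base : ∀ x y → x ⟦ y ⟧ ⊔ x ≡ x ⟦ y ⟧
  bracket-absorbs-base x y = begin
    x ⟦ y ⟧ ⊔ x             ≡⟨ cong (x ⟦ y ⟧ ⊔_) (sym (bracket-back x y)) ⟩
    x ⟦ y ⟧ ⊔ x ⟦ y ⟧ ⟦ x ⟧ ≡⟨ ⊔-absorbs-bracket (x ⟦ y ⟧) x ⟩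
    x ⟦ y ⟧                 ∎

  bracket-comm : ∀ x y → x ⟦ y ⟧ ⊔ y ≡ y ⊔ x ⟦ y ⟧
  bracket-comm x y = sym (begin
    y ⊔ x ⟦ y ⟧       ≡⟨ ax2 y (x ⟦ y ⟧) ⟩
    x ⟦ y ⟧ ⟦ y ⟧ ⊔ y ≡⟨ cong (_⊔ y) (bracket-twice x y) ⟩
    x ⟦ y ⟧ ⊔ y       ∎)

  join-bracket : ∀ x y → y ⊔ x ⟦ y ⟧ ≡ y ⊔ x
  join-bracket x y = sym (begin
    y ⊔ x       ≡⟨ ax2 y x ⟩
    x ⟦ y ⟧ ⊔ y ≡⟨ bracket-comm x y ⟩
    y ⊔ x ⟦ y ⟧ ∎)

  left-regular : ∀ x y → (x ⊔ y) ⊔ x ≡ x ⊔ y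
  left-regular x y = begin
    (x ⊔ y) ⊔ x           ≡⟨ ax2 (x ⊔ y) x ⟩
    x ⟦ x ⊔ y ⟧ ⊔ (x ⊔ y) ≡⟨ cong (_⊔ (x ⊔ y)) (sym (ax1 x y)) ⟩
    x ⊔ (x ⊔ y)           ≡⟨ sym (⊔-assoc x x y) ⟩
    (x ⊔ x) ⊔ y           ≡⟨ cong (_⊔ y) (⊔-idem x) ⟩
    x ⊔ y                 ∎

lemma5p4 : {a : Level} (𝔸 : Algebra a) → Axioms 𝔸 → Conclusions 𝔸
lemma5p4 𝔸 axioms = record
  { c1 = bracket-absorbs-base
  ; c2 = ⊔-absorbs-bracket
  ; c3 = bracket-comm
  ; c4 = join-bracket
  ; c5 = λ x y z → sym (⊔-assoc x y z)
  ; c6 = ⊔-idem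
  ; c7 = left-regular
  }
  where
  open Axioms axioms
  open Consequences 𝔸 axioms
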